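{- Let $G$ be a graph, $h$ a positive integral weight function on $V(G)$, and $x\in V(G)$. Let $G_x$ be the graph obtained from $G$ by replacing $x$ with a clique $X$ of $h(x)$ vertices (with $x\in X$), each vertex of $X$ being adjacent to exactly the vertices of $X$ other than itself and the neighbors of $x$ in $G$; and let $h_x$ be the weight function on $V(G_x)$ with $h_x(v)=h(v)$ for $v\notin X$ and $h_x(v)=1$ for $v\in X$. If $G_x$ is $h_x$-perfectly divisible, then $G$ is $h$-perfectly divisible.
   Context: For a positive integral weight function $h$ on $V(G)$ and $S\subseteq V(G)$, $\omega_h(S)$ is the maximum total $h$-weight of a clique of $G[S]$. An $h$-perfect division of $G$ is a partition $(A,B)$ of $V(G)$ with $G[A]$ perfect and $\omega_h(B)<\omega_h(V(G))$. $G$ is $h$-perfectly divisible if every nonempty induced subgraph $H$ of $G$ has an $h|_{V(H)}$-perfect division. -}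

module Defs where

open import Data.Nat using (ℕ; _<_; _≤_; _+_; _∸_)
open import Data.Fin using (Fin; splitAt; _≟_)
open import Data.Fin.Subset using (Subset; _∈_; _⊆_; _─_; ∣_∣; Nonempty)
open import Data.Fin.Subset.Properties using (_∈?_)
open import Data.Vec using (tabulate; sum)
open import Data.Sum using (_⊎_; inj₁; inj₂)
open import Data.Product using (Σ; _×_; _,_; ∃)
open import Data.Bool using (if_then_else_)
open import Relation.Nullary using (¬_; does)
open import Relation.Binary.PropositionalEquality using (_≡_; _≢_) renaming (sym to ≡-sym)

record Graph : Set₁ where
  field
    n      : ℕ
    Adj    : Fin n → Fin n → Set
    adj-sym : ∀ {u v} → Adj u v → Adj v u
    irrefl : ∀ {u} → ¬ Adj u u

open Graph public

Weight : Graph → Set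
Weight G = Fin (n G) → ℕ

Positive : (G : Graph) → Weight G → Set
Positive G h = ∀ v → 0 < h v

IsCliqueIn : (G : Graph) → Subset (n G) → Subset (n G) → Set
IsCliqueIn G S C = C ⊆ S × (∀ {u v} → u ∈ C → v ∈ C → u ≢ v → Adj G u v)

weight : (G : Graph) → Weight G → Subset (n G) → ℕ
weight G h C = sum (tabulate λ i → if does (i ∈? C) then h i else 0)

IsWeightedCliqueNumber : (G : Graph) → Weight G → Subset (n G) → ℕ → Set
IsWeightedCliqueNumber G h S w =
  (Σ (Subset (n G)) λ C → IsCliqueIn G S C × weight G h C ≡ w)
  × (∀ C → IsCliqueIn G S C → weight G h C ≤ w)

IsCliqueNumber : (G : Graph) → Subset (n G) → ℕ → Set
IsCliqueNumber G S w =
  (Σ (Subset (n G)) λ C → IsCliqueIn G S C × ∣ C ∣ ≡ w)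
  × (∀ C → IsCliqueIn G S C → ∣ C ∣ ≤ w)

Colourable : (G : Graph) → Subset (n G) → ℕ → Set
Colourable G S k =
  Σ ((v : Fin (n G)) → v ∈ S → Fin k) λ c →
    ∀ {u v} (u∈ : u ∈ S) (v∈ : v ∈ S) → Adj G u v → c u u∈ ≢ c v v∈

-- G[A] is perfect: every induced subgraph G[T] (T ⊆ A) has χ(G[T]) = ω(G[T]),
-- i.e. (since χ ≥ ω always) G[T] is ω(G[T])-colourable.
Perfect : (G : Graph) → Subset (n G) → Set
Perfect G A = ∀ T → T ⊆ A → ∀ w → IsCliqueNumber G T w → Colourable G T w

HasPerfectDivision : (G : Graph) → Weight G → Subset (n G) → Set
HasPerfectDivision G h S =
  Σ (Subset (n G)) λ A → A ⊆ S × Perfect G A ×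
    ∃ λ wB → ∃ λ wS → IsWeightedCliqueNumber G h (S ─ A) wB
                      × IsWeightedCliqueNumber G h S wS × wB < wS

PerfectlyDivisible : (G : Graph) → Weight G → Set
PerfectlyDivisible G h = ∀ S → Nonempty S → HasPerfectDivision G h S

-- Blow-up of x into a clique X of h(x) vertices: vertex set Fin (n + (h x ∸ 1)),
-- the first n vertices are those of G (x itself stays x), the extra h x ∸ 1 vertices
-- are the other members of X.  orig maps each vertex of G_x to the vertex of G it comes from.
module _ (G : Graph) (h : Weight G) (x : Fin (n G)) where

  nX : ℕ
  nX = n G + (h x ∸ 1)

  orig : Fin nX → Fin (n G)
  orig u with splitAt (n G) u
  ... | inj₁ v = v
  ... | inj₂ _ = x

  AdjX : Fin nX → Fin nX → Set
  AdjX u v = u ≢ v × (orig u ≡ x × orig v ≡ x ⊎ Adj G (orig u) (orig v))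

  blowUp : Graph
  blowUp = record
    { n = nX
    ; Adj = AdjX
    ; adj-sym = λ { (ne , inj₁ (a , b)) → (λ e → ne (≡-sym e)) , inj₁ (b , a)
              ; (ne , inj₂ a) → (λ e → ne (≡-sym e)) , inj₂ (Graph.adj-sym G a) }
    ; irrefl = λ { (ne , _) → ne _≡_.refl }
    }

  blowUpWeight : Weight blowUp
  blowUpWeight u with orig u ≟ x
  ... | Relation.Nullary.yes _ = 1
  ... | Relation.Nullary.no _ = h (orig u)

-- A nonempty S ⊆ V(G) lifts to π⁻¹(S) ⊆ V(Gₓ), where π collapses X onto x; take a division
-- (A′, B′) of it. Cliques of G[S] lift to cliques of Gₓ[π⁻¹ S] of the same weight (X consists
-- of h(x) vertices of weight 1), and cliques of Gₓ project to cliques of no smaller weight, so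
-- ω_h(S) = ω_hₓ(π⁻¹ S). Embed G into Gₓ as an induced subgraph ι sending x into X, into A′
-- whenever A′ meets X, and put A = ι⁻¹(A′). Then G[A] is an induced subgraph of the perfect
-- graph Gₓ[A′], and the choice of ι(x) gives π⁻¹(S ∖ A) ⊆ B′, whence
-- ω_h(S ∖ A) ≤ ω(B′) < ω(π⁻¹ S) = ω_h(S).
module Submission where

open import Defs
open import Data.Fin using (Fin; zero; suc; _↑ˡ_; _↑ʳ_; splitAt; _≟_)
open import Data.Fin.Properties using (any?; 0≢1+n; splitAt-↑ˡ; splitAt-↑ʳ; splitAt⁻¹-↑ˡ)
  renaming (suc-injective to Fin-suc-injective)
open import Data.Fin.Subset
  using (Subset; _∈_; _∉_; _⊆_; _─_; _-_; ∣_∣; Nonempty; Empty; inside; outside)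
  renaming (⊥ to ∅)
open import Data.Fin.Subset.Properties
  using (_∈?_; ∉⊥; nonempty?; x∈p⇒∣p-x∣<∣p∣; x∈p∧x≢y⇒x∈p-y; x∈p∧x∉q⇒x∈p─q; p─q⊆p)
open import Data.Vec using (_∷_; []; here; there; tabulate; sum)
open import Data.Vec.Properties using (lookup∘tabulate; lookup⇒[]=; []=⇒lookup; tabulate-cong)
open import Data.Nat using (ℕ; _+_; _*_; _∸_; _≤_; _<_; z≤n; s≤s)
open import Data.Nat.Properties
  using ( ≤-refl; ≤-trans; ≤-antisym; ≤-reflexive; ≤-<-trans; +-mono-≤; +-assoc; +-comm
        ; *-zeroʳ; *-identityʳ; m∸n+n≡m; +-commutativeSemigroup)
open import Algebra.Properties.CommutativeSemigroup +-commutativeSemigroup using (xy∙z≈xz∙y)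
open import Data.Product using (Σ; ∃; _×_; _,_; proj₁; proj₂)
open import Data.Sum using (inj₁; inj₂)
open import Data.Bool using (if_then_else_)
open import Function using (_∘_; const)
open import Function.Bundles using (mk⇔)
open import Relation.Nullary using (Dec; yes; no; does; contradiction)
open import Relation.Nullary.Decidable using (dec-true; does-⇔; _×-dec_)
open import Relation.Binary.PropositionalEquality

select : ∀ {m} {P : Fin m → Set} → (∀ i → Dec (P i)) → Subset m
select P? = tabulate (does ∘ P?)

module _ {m} {P : Fin m → Set} (P? : ∀ i → Dec (P i)) where

  ∈-select⁺ : ∀ {i} → P i → i ∈ select P?
  ∈-select⁺ {i} p =
    lookup⇒[]= i _ (trans (lookup∘tabulate (does ∘ P?) i) (dec-true (P? i) p))

  ∈-select⁻ : ∀ {i} → i ∈ select P? → P i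
  ∈-select⁻ {i} i∈ with P? i | trans (sym (lookup∘tabulate (does ∘ P?) i)) ([]=⇒lookup i∈)
  ... | yes p | _ = p
  ... | no _  | ()

module _ {a b} (f : Fin a → Fin b) where

  preimage : Subset b → Subset a
  preimage Z = select (λ v → f v ∈? Z)

  hits? : ∀ Z u → Dec (∃ λ v → v ∈ Z × f v ≡ u)
  hits? Z u = any? (λ v → (v ∈? Z) ×-dec (f v ≟ u))

  image : Subset a → Subset b
  image Z = select (hits? Z)

  ∈-preimage⁺ : ∀ {Z v} → f v ∈ Z → v ∈ preimage Z
  ∈-preimage⁺ {Z} = ∈-select⁺ (λ v → f v ∈? Z)

  ∈-preimage⁻ : ∀ {Z v} → v ∈ preimage Z → f v ∈ Z
  ∈-preimage⁻ {Z} = ∈-select⁻ (λ v → f v ∈? Z)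

  ∈-image⁺ : ∀ {Z v} → v ∈ Z → f v ∈ image Z
  ∈-image⁺ {Z} v∈ = ∈-select⁺ (hits? Z) (_ , v∈ , refl)

  ∈-image⁻ : ∀ {Z u} → u ∈ image Z → ∃ λ v → v ∈ Z × f v ≡ u
  ∈-image⁻ {Z} = ∈-select⁻ (hits? Z)

  preimage-mono : ∀ {Y Z} → Y ⊆ Z → preimage Y ⊆ preimage Z
  preimage-mono Y⊆Z v∈ = ∈-preimage⁺ (Y⊆Z (∈-preimage⁻ v∈))

  image-mono : ∀ {Y Z} → Y ⊆ Z → image Y ⊆ image Z
  image-mono Y⊆Z u∈ with ∈-image⁻ u∈
  ... | v , v∈Y , refl = ∈-image⁺ (Y⊆Z v∈Y)

  ⊆preimage⇒image⊆ : ∀ {Y Z} → Y ⊆ preimage Z → image Y ⊆ Z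
  ⊆preimage⇒image⊆ Y⊆ u∈ with ∈-image⁻ u∈
  ... | v , v∈Y , refl = ∈-preimage⁻ (Y⊆ v∈Y)

  ⊆-preimage-image : ∀ Y → Y ⊆ preimage (image Y)
  ⊆-preimage-image Y v∈ = ∈-preimage⁺ (∈-image⁺ v∈)

x∈p─q⇒x∉q : ∀ {m} {x : Fin m} {p q : Subset m} → x ∈ p ─ q → x ∉ q
x∈p─q⇒x∉q {p = _ ∷ _} {outside ∷ _} here      ()
x∈p─q⇒x∉q {p = _ ∷ _} {_ ∷ _}       (there x∈) (there x∈q) = x∈p─q⇒x∉q x∈ x∈q

injectiveOn⇒∣p∣≤∣q∣ : ∀ {a b} {p : Subset a} {q : Subset b} (f : Fin a → Fin b) →
  (∀ {v} → v ∈ p → f v ∈ q) → (∀ {u v} → u ∈ p → v ∈ p → f u ≡ f v → u ≡ v) → ∣ p ∣ ≤ ∣ q ∣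
injectiveOn⇒∣p∣≤∣q∣ {p = []}          f f∈ f-inj = z≤n
injectiveOn⇒∣p∣≤∣q∣ {p = outside ∷ p} f f∈ f-inj =
  injectiveOn⇒∣p∣≤∣q∣ (f ∘ suc) (f∈ ∘ there) (λ u∈ v∈ → Fin-suc-injective ∘ f-inj (there u∈) (there v∈))
injectiveOn⇒∣p∣≤∣q∣ {p = inside ∷ p} {q} f f∈ f-inj =
  ≤-trans (s≤s (injectiveOn⇒∣p∣≤∣q∣ (f ∘ suc) f∘suc∈q-f₀ f∘suc-inj)) (x∈p⇒∣p-x∣<∣p∣ (f∈ here))
  where
  f∘suc∈q-f₀ : ∀ {v} → v ∈ p → f (suc v) ∈ q - f zero
  f∘suc∈q-f₀ v∈ = x∈p∧x≢y⇒x∈p-y (f∈ (there v∈)) (0≢1+n ∘ f-inj here (there v∈) ∘ sym)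
  f∘suc-inj : ∀ {u v} → u ∈ p → v ∈ p → f (suc u) ≡ f (suc v) → u ≡ v
  f∘suc-inj u∈ v∈ = Fin-suc-injective ∘ f-inj (there u∈) (there v∈)

sum-tabulate-mono : ∀ {m} {f g : Fin m → ℕ} → (∀ i → f i ≤ g i) →
  sum (tabulate f) ≤ sum (tabulate g)
sum-tabulate-mono {ℕ.zero}  f≤g = z≤n
sum-tabulate-mono {ℕ.suc m} f≤g = +-mono-≤ (f≤g zero) (sum-tabulate-mono (f≤g ∘ suc))

sum-tabulate-const : ∀ m c → sum (tabulate {n = m} (const c)) ≡ m * c
sum-tabulate-const ℕ.zero    c = refl
sum-tabulate-const (ℕ.suc m) c = cong (c +_) (sum-tabulate-const m c)

sum-tabulate-↑ : ∀ m {k} (f : Fin (m + k) → ℕ) →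
  sum (tabulate f) ≡ sum (tabulate (f ∘ (_↑ˡ k))) + sum (tabulate (f ∘ (m ↑ʳ_)))
sum-tabulate-↑ ℕ.zero    f = refl
sum-tabulate-↑ (ℕ.suc m) f =
  trans (cong (f zero +_) (sum-tabulate-↑ m (f ∘ suc))) (sym (+-assoc (f zero) _ _))

sum-tabulate-except : ∀ {m} {f g : Fin m → ℕ} x {d} → (∀ v → v ≢ x → f v ≡ g v) → g x ≡ f x + d →
  sum (tabulate g) ≡ sum (tabulate f) + d
sum-tabulate-except {f = f} {g} zero {d} f≡g gx≡fx+d = begin
  g zero + sum (tabulate (g ∘ suc))      ≡⟨ cong₂ _+_ gx≡fx+d (cong sum (tabulate-cong g≗f)) ⟩
  f zero + d + sum (tabulate (f ∘ suc))  ≡⟨ xy∙z≈xz∙y (f zero) d _ ⟩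
  f zero + sum (tabulate (f ∘ suc)) + d  ∎
  where
  open ≡-Reasoning
  g≗f : ∀ v → g (suc v) ≡ f (suc v)
  g≗f v = sym (f≡g (suc v) (0≢1+n ∘ sym))
sum-tabulate-except {f = f} {g} (suc x) {d} f≡g gx≡fx+d = begin
  g zero + sum (tabulate (g ∘ suc))        ≡⟨ cong₂ _+_ (sym (f≡g zero 0≢1+n)) IH ⟩
  f zero + (sum (tabulate (f ∘ suc)) + d)  ≡⟨ +-assoc (f zero) _ d ⟨
  f zero + sum (tabulate (f ∘ suc)) + d    ∎
  where
  open ≡-Reasoning
  IH : sum (tabulate (g ∘ suc)) ≡ sum (tabulate (f ∘ suc)) + d
  IH = sum-tabulate-except x (λ v v≢x → f≡g (suc v) (v≢x ∘ Fin-suc-injective)) gx≡fx+d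

module _ (H : Graph) (w : Weight H) where

  weight-mono : ∀ {C D} → C ⊆ D → weight H w C ≤ weight H w D
  weight-mono {C} {D} C⊆D = sum-tabulate-mono termwise
    where
    termwise : ∀ i → (if does (i ∈? C) then w i else 0) ≤ (if does (i ∈? D) then w i else 0)
    termwise i with i ∈? C | i ∈? D
    ... | yes _   | yes _   = ≤-refl
    ... | yes i∈C | no i∉D  = contradiction (C⊆D i∈C) i∉D
    ... | no _    | _       = z≤n

  weight-empty : ∀ {C} → Empty C → weight H w C ≡ 0
  weight-empty {C} empty = begin
    weight H w C                        ≡⟨ cong sum (tabulate-cong termwise) ⟩
    sum (tabulate {n = n H} (const 0))  ≡⟨ sum-tabulate-const (n H) 0 ⟩
    n H * 0                             ≡⟨ *-zeroʳ (n H) ⟩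
    0                                   ∎
    where
    open ≡-Reasoning
    termwise : ∀ i → (if does (i ∈? C) then w i else 0) ≡ 0
    termwise i with i ∈? C
    ... | yes i∈C = contradiction (i , i∈C) empty
    ... | no _    = refl

  weightedCliqueNumber-mono : ∀ {S T a b} → S ⊆ T →
    IsWeightedCliqueNumber H w S a → IsWeightedCliqueNumber H w T b → a ≤ b
  weightedCliqueNumber-mono S⊆T ((C , (C⊆S , C-clique) , wC≡a) , _) (_ , maximal) =
    subst (_≤ _) wC≡a (maximal C ((λ v∈C → S⊆T (C⊆S v∈C)) , C-clique))

  weightedCliqueNumber-empty : ∀ {S} → Empty S → IsWeightedCliqueNumber H w S 0
  weightedCliqueNumber-empty empty =
    (∅ , ((λ v∈∅ → contradiction v∈∅ ∉⊥) , (λ v∈∅ → contradiction v∈∅ ∉⊥)) ,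
         weight-empty λ (_ , v∈∅) → ∉⊥ v∈∅) ,
    λ C (C⊆S , _) → ≤-reflexive (weight-empty λ (v , v∈C) → empty (v , C⊆S v∈C))

  -- ω_w(S) always exists; reading it off a division avoids a search over all cliques.
  weightedCliqueNumber-exists : PerfectlyDivisible H w → ∀ S → ∃ (IsWeightedCliqueNumber H w S)
  weightedCliqueNumber-exists divisible S with nonempty? S
  ... | no empty = 0 , weightedCliqueNumber-empty empty
  ... | yes nonempty with divisible S nonempty
  ...   | _ , _ , _ , _ , wS , _ , ωS , _ = wS , ωS

record InducedEmbedding (G H : Graph) : Set where
  field
    embed         : Fin (n G) → Fin (n H)
    retract       : Fin (n H) → Fin (n G)
    retract-embed : ∀ v → retract (embed v) ≡ v
    Adj-reflect   : ∀ {u v} → Adj H (embed u) (embed v) → Adj G u v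
    Adj-preserve  : ∀ {u v} → Adj G u v → Adj H (embed u) (embed v)

module _ {G H : Graph} (e : InducedEmbedding G H) where

  open InducedEmbedding e

  embed-injective : ∀ {u v} → embed u ≡ embed v → u ≡ v
  embed-injective {u} {v} eq =
    trans (sym (retract-embed u)) (trans (cong retract eq) (retract-embed v))

  embed-retract-image : ∀ {Z u} → u ∈ image embed Z → embed (retract u) ≡ u
  embed-retract-image u∈ with ∈-image⁻ embed u∈
  ... | v , _ , refl = cong embed (retract-embed v)

  retract-image : ∀ {Z u} → u ∈ image embed Z → retract u ∈ Z
  retract-image {Z} u∈ with ∈-image⁻ embed u∈
  ... | v , v∈Z , refl = subst (_∈ Z) (sym (retract-embed v)) v∈Z

  retract-injective-image : ∀ {Z u v} → u ∈ image embed Z → v ∈ image embed Z →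
    retract u ≡ retract v → u ≡ v
  retract-injective-image u∈ v∈ eq =
    trans (sym (embed-retract-image u∈)) (trans (cong embed eq) (embed-retract-image v∈))

  ∣image∣≡∣p∣ : ∀ C → ∣ image embed C ∣ ≡ ∣ C ∣
  ∣image∣≡∣p∣ C = ≤-antisym
    (injectiveOn⇒∣p∣≤∣q∣ retract retract-image retract-injective-image)
    (injectiveOn⇒∣p∣≤∣q∣ embed (∈-image⁺ embed) (λ _ _ → embed-injective))

  image-embed-clique : ∀ {T C} → IsCliqueIn G T C →
    IsCliqueIn H (image embed T) (image embed C)
  image-embed-clique {C = C} (C⊆T , C-clique) = image-mono embed C⊆T , adjacent
    where
    adjacent : ∀ {u v} → u ∈ image embed C → v ∈ image embed C → u ≢ v → Adj H u v
    adjacent u∈ v∈ u≢v with ∈-image⁻ embed u∈ | ∈-image⁻ embed v∈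
    ... | u′ , u′∈C , refl | v′ , v′∈C , refl =
      Adj-preserve (C-clique u′∈C v′∈C (u≢v ∘ cong embed))

  preimage-embed-clique : ∀ {T D} → IsCliqueIn H (image embed T) D →
    IsCliqueIn G T (preimage embed D)
  preimage-embed-clique {T} {D} (D⊆T′ , D-clique) = ⊆T , adjacent
    where
    ⊆T : ∀ {v} → v ∈ preimage embed D → v ∈ T
    ⊆T v∈ = subst (_∈ T) (retract-embed _) (retract-image (D⊆T′ (∈-preimage⁻ embed v∈)))
    adjacent : ∀ {u v} → u ∈ preimage embed D → v ∈ preimage embed D → u ≢ v → Adj G u v
    adjacent u∈ v∈ u≢v =
      Adj-reflect (D-clique (∈-preimage⁻ embed u∈) (∈-preimage⁻ embed v∈) (u≢v ∘ embed-injective))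

  ∣p∣≤∣preimage∣ : ∀ {T D} → D ⊆ image embed T → ∣ D ∣ ≤ ∣ preimage embed D ∣
  ∣p∣≤∣preimage∣ {D = D} D⊆T′ = injectiveOn⇒∣p∣≤∣q∣ retract
    (λ u∈D → ∈-preimage⁺ embed (subst (_∈ D) (sym (embed-retract-image (D⊆T′ u∈D))) u∈D))
    (λ u∈D v∈D → retract-injective-image (D⊆T′ u∈D) (D⊆T′ v∈D))

  cliqueNumber-image : ∀ {T ω} → IsCliqueNumber G T ω → IsCliqueNumber H (image embed T) ω
  cliqueNumber-image ((C , C-clique , ∣C∣≡ω) , maximal) =
    (image embed C , image-embed-clique C-clique , trans (∣image∣≡∣p∣ C) ∣C∣≡ω) ,
    λ D D-clique →
      ≤-trans (∣p∣≤∣preimage∣ (proj₁ D-clique)) (maximal _ (preimage-embed-clique D-clique))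

  Perfect-preimage : ∀ {A} → Perfect H A → Perfect G (preimage embed A)
  Perfect-preimage perfect T T⊆A ω ω-T
    with perfect (image embed T) (⊆preimage⇒image⊆ embed T⊆A) ω (cliqueNumber-image ω-T)
  ... | colour , proper =
    (λ v v∈T → colour (embed v) (∈-image⁺ embed v∈T)) ,
    λ u∈T v∈T uv → proper (∈-image⁺ embed u∈T) (∈-image⁺ embed v∈T) (Adj-preserve uv)

module BlowUp (G : Graph) (h : Weight G) (x : Fin (n G)) where

  k : ℕ
  k = h x ∸ 1

  Gₓ : Graph
  Gₓ = blowUp G h x

  hₓ : Weight Gₓ
  hₓ = blowUpWeight G h x

  π : Fin (n Gₓ) → Fin (n G)
  π = orig G h x

  lift : Subset (n G) → Subset (n Gₓ)
  lift = preimage π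

  π-↑ˡ : ∀ v → π (v ↑ˡ k) ≡ v
  π-↑ˡ v rewrite splitAt-↑ˡ (n G) v k = refl

  π-↑ʳ : ∀ j → π (n G ↑ʳ j) ≡ x
  π-↑ʳ j rewrite splitAt-↑ʳ (n G) k j = refl

  ↑ˡ-π : ∀ u → π u ≢ x → π u ↑ˡ k ≡ u
  ↑ˡ-π u π≢x with splitAt (n G) u in eq
  ... | inj₁ _ = splitAt⁻¹-↑ˡ eq
  ... | inj₂ _ = contradiction refl π≢x

  π-injective-off-x : ∀ {u v} → π u ≡ π v → π u ≢ x → u ≡ v
  π-injective-off-x {u} {v} eq π≢x =
    trans (sym (↑ˡ-π u π≢x)) (trans (cong (_↑ˡ k) eq) (↑ˡ-π v (π≢x ∘ trans eq)))

  h′ : Weight G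
  h′ v with v ≟ x
  ... | yes _ = 1
  ... | no _  = h v

  hₓ≡h′∘π : ∀ u → hₓ u ≡ h′ (π u)
  hₓ≡h′∘π u with π u ≟ x
  ... | yes _ = refl
  ... | no _  = refl

  h′-x : h′ x ≡ 1
  h′-x with x ≟ x
  ... | yes _   = refl
  ... | no x≢x = contradiction refl x≢x

  h′-off-x : ∀ v → v ≢ x → h′ v ≡ h v
  h′-off-x v v≢x with v ≟ x
  ... | yes v≡x = contradiction v≡x v≢x
  ... | no _    = refl

  -- The fibre of x is x ↑ˡ k together with the n G ↑ʳ j: 1 + k = h x vertices of weight 1.
  weight-lift : 0 < h x → ∀ C → weight Gₓ hₓ (lift C) ≡ weight G h C
  weight-lift hx>0 C = begin
    weight Gₓ hₓ (lift C)
      ≡⟨ sum-tabulate-↑ (n G) term ⟩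
    sum (tabulate (term ∘ (_↑ˡ k))) + sum (tabulate (term ∘ (n G ↑ʳ_)))
      ≡⟨ cong₂ _+_ (cong sum (tabulate-cong λ v → trans (term-π (v ↑ˡ k)) (cong term′ (π-↑ˡ v))))
                   (cong sum (tabulate-cong λ j → trans (term-π (n G ↑ʳ j)) (cong term′ (π-↑ʳ j)))) ⟩
    weight G h′ C + sum (tabulate {n = k} (const (term′ x)))
      ≡⟨ cong (weight G h′ C +_) (sum-tabulate-const k (term′ x)) ⟩
    weight G h′ C + k * term′ x
      ≡⟨ sum-tabulate-except x agree-off-x term-x ⟨
    weight G h C ∎
    where
    open ≡-Reasoning
    term : Fin (n Gₓ) → ℕ
    term u = if does (u ∈? lift C) then hₓ u else 0
    term′ : Fin (n G) → ℕ
    term′ v = if does (v ∈? C) then h′ v else 0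
    term-π : ∀ u → term u ≡ term′ (π u)
    term-π u = cong₂ (λ b w → if b then w else 0)
      (does-⇔ (mk⇔ (∈-preimage⁻ π) (∈-preimage⁺ π)) (u ∈? lift C) (π u ∈? C)) (hₓ≡h′∘π u)
    agree-off-x : ∀ v → v ≢ x → term′ v ≡ (if does (v ∈? C) then h v else 0)
    agree-off-x v v≢x = cong (λ w → if does (v ∈? C) then w else 0) (h′-off-x v v≢x)
    term-x : (if does (x ∈? C) then h x else 0) ≡ term′ x + k * term′ x
    term-x with x ∈? C
    ... | no _  = sym (*-zeroʳ k)
    ... | yes _ = begin
      h x          ≡⟨ m∸n+n≡m hx>0 ⟨
      k + 1        ≡⟨ +-comm k 1 ⟩
      1 + k        ≡⟨ cong (1 +_) (*-identityʳ k) ⟨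
      1 + k * 1    ≡⟨ cong (λ c → c + k * c) h′-x ⟨
      h′ x + k * h′ x ∎

  lift-clique : ∀ {S C} → IsCliqueIn G S C → IsCliqueIn Gₓ (lift S) (lift C)
  lift-clique {C = C} (C⊆S , C-clique) = preimage-mono π C⊆S , adjacent
    where
    π-adjacent : ∀ {u v} → u ∈ lift C → v ∈ lift C → π u ≢ π v → Adj G (π u) (π v)
    π-adjacent u∈ v∈ = C-clique (∈-preimage⁻ π u∈) (∈-preimage⁻ π v∈)
    adjacent : ∀ {u v} → u ∈ lift C → v ∈ lift C → u ≢ v → Adj Gₓ u v
    adjacent {u} {v} u∈ v∈ u≢v with π u ≟ x | π v ≟ x
    ... | yes πu≡x | yes πv≡x = u≢v , inj₁ (πu≡x , πv≡x)
    ... | yes πu≡x | no πv≢x  = u≢v , inj₂ (π-adjacent u∈ v∈ λ eq → πv≢x (trans (sym eq) πu≡x))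
    ... | no πu≢x  | _        = u≢v , inj₂ (π-adjacent u∈ v∈ λ eq → u≢v (π-injective-off-x eq πu≢x))

  image-π-clique : ∀ {S C} → IsCliqueIn Gₓ (lift S) C → IsCliqueIn G S (image π C)
  image-π-clique {C = C} (C⊆S′ , C-clique) = ⊆preimage⇒image⊆ π C⊆S′ , adjacent
    where
    adjacent : ∀ {v w} → v ∈ image π C → w ∈ image π C → v ≢ w → Adj G v w
    adjacent v∈ w∈ v≢w with ∈-image⁻ π v∈ | ∈-image⁻ π w∈
    ... | u , u∈C , refl | u′ , u′∈C , refl with C-clique u∈C u′∈C (v≢w ∘ cong π)
    ...   | _ , inj₁ (πu≡x , πu′≡x) = contradiction (trans πu≡x (sym πu′≡x)) v≢w
    ...   | _ , inj₂ πu~πu′         = πu~πu′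

  weightedCliqueNumber-lift : 0 < h x → ∀ {S ω} →
    IsWeightedCliqueNumber Gₓ hₓ (lift S) ω → IsWeightedCliqueNumber G h S ω
  weightedCliqueNumber-lift hx>0 {S} {ω} ((C , C-clique , wC≡ω) , maximal) =
    (image π C , image-π-clique C-clique , ≤-antisym (bound _ (image-π-clique C-clique)) ω≤) , bound
    where
    bound : ∀ D → IsCliqueIn G S D → weight G h D ≤ ω
    bound D D-clique = subst (_≤ ω) (weight-lift hx>0 D) (maximal (lift D) (lift-clique D-clique))
    ω≤ : ω ≤ weight G h (image π C)
    ω≤ = subst₂ _≤_ wC≡ω (weight-lift hx>0 (image π C)) (weight-mono Gₓ hₓ (⊆-preimage-image π C))

  module _ (x′ : Fin (n Gₓ)) (π-x′ : π x′ ≡ x) where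

    ι : Fin (n G) → Fin (n Gₓ)
    ι v with v ≟ x
    ... | yes _ = x′
    ... | no _  = v ↑ˡ k

    π-ι : ∀ v → π (ι v) ≡ v
    π-ι v with v ≟ x
    ... | yes v≡x = trans π-x′ (sym v≡x)
    ... | no _    = π-↑ˡ v

    ι-injective : ∀ {u v} → ι u ≡ ι v → u ≡ v
    ι-injective {u} {v} ιu≡ιv = trans (sym (π-ι u)) (trans (cong π ιu≡ιv) (π-ι v))

    ι-embedding : InducedEmbedding G Gₓ
    ι-embedding = record
      { embed         = ι
      ; retract       = π
      ; retract-embed = π-ι
      ; Adj-reflect   = reflect
      ; Adj-preserve  = preserve
      }
      where
      reflect : ∀ {u v} → Adj Gₓ (ι u) (ι v) → Adj G u v
      reflect {u} {v} (ιu≢ιv , inj₁ (πιu≡x , πιv≡x)) =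
        contradiction (cong ι (trans (sym (π-ι u)) (trans πιu≡x (trans (sym πιv≡x) (π-ι v))))) ιu≢ιv
      reflect {u} {v} (_ , inj₂ πιu~πιv) = subst₂ (Adj G) (π-ι u) (π-ι v) πιu~πιv
      preserve : ∀ {u v} → Adj G u v → Adj Gₓ (ι u) (ι v)
      preserve {u} {v} u~v =
        (λ ιu≡ιv → irrefl G (subst (Adj G u) (sym (ι-injective ιu≡ιv)) u~v)) ,
        inj₂ (subst₂ (Adj G) (sym (π-ι u)) (sym (π-ι v)) u~v)

    module _ {A′ : Subset (n Gₓ)} (x′-closed : ∀ {u} → u ∈ A′ → π u ≡ x → x′ ∈ A′) where

      ι∘π-closed : ∀ {u} → u ∈ A′ → ι (π u) ∈ A′
      ι∘π-closed {u} u∈A′ with π u ≟ x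
      ... | yes πu≡x = x′-closed u∈A′ πu≡x
      ... | no πu≢x  = subst (_∈ A′) (sym (↑ˡ-π u πu≢x)) u∈A′

      lift-─ : ∀ {S} → lift (S ─ preimage ι A′) ⊆ lift S ─ A′
      lift-─ {S} {u} u∈ = x∈p∧x∉q⇒x∈p─q (∈-preimage⁺ π (p─q⊆p _ _ πu∈S─A))
                                (λ u∈A′ → x∈p─q⇒x∉q πu∈S─A (∈-preimage⁺ ι (ι∘π-closed u∈A′)))
        where
        πu∈S─A : π u ∈ S ─ preimage ι A′
        πu∈S─A = ∈-preimage⁻ π u∈

  representative : ∀ A′ → Σ (Fin (n Gₓ)) λ x′ → π x′ ≡ x × (∀ {u} → u ∈ A′ → π u ≡ x → x′ ∈ A′)
  representative A′ with any? (λ u → (u ∈? A′) ×-dec (π u ≟ x))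
  ... | yes (x′ , x′∈A′ , π-x′) = x′ , π-x′ , λ _ _ → x′∈A′
  ... | no none                 = x ↑ˡ k , π-↑ˡ x , λ u∈A′ πu≡x → contradiction (_ , u∈A′ , πu≡x) none

  lift-nonempty : ∀ {S} → Nonempty S → Nonempty (lift S)
  lift-nonempty {S} (v , v∈S) = v ↑ˡ k , ∈-preimage⁺ π (subst (_∈ S) (sym (π-↑ˡ v)) v∈S)

  division-unlift : 0 < h x → PerfectlyDivisible Gₓ hₓ → ∀ {S} →
    HasPerfectDivision Gₓ hₓ (lift S) → HasPerfectDivision G h S
  division-unlift hx>0 divisible {S} (A′ , A′⊆S′ , A′-perfect , ωB′ , ωS , B′-ω , S′-ω , ωB′<ωS)
    with representative A′
  ... | x′ , π-x′ , x′-closed =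
    A , A⊆S , Perfect-preimage (ι-embedding x′ π-x′) A′-perfect ,
    ωB , ωS , weightedCliqueNumber-lift hx>0 liftB-ω , weightedCliqueNumber-lift hx>0 S′-ω ,
    ≤-<-trans (weightedCliqueNumber-mono Gₓ hₓ (lift-─ x′ π-x′ x′-closed) liftB-ω B′-ω) ωB′<ωS
    where
    A : Subset (n G)
    A = preimage (ι x′ π-x′) A′
    A⊆S : A ⊆ S
    A⊆S {v} v∈A = subst (_∈ S) (π-ι x′ π-x′ v) (∈-preimage⁻ π (A′⊆S′ (∈-preimage⁻ (ι x′ π-x′) v∈A)))
    ωB : ℕ
    ωB = proj₁ (weightedCliqueNumber-exists Gₓ hₓ divisible (lift (S ─ A)))
    liftB-ω : IsWeightedCliqueNumber Gₓ hₓ (lift (S ─ A)) ωB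
    liftB-ω = proj₂ (weightedCliqueNumber-exists Gₓ hₓ divisible (lift (S ─ A)))

lemma2 : (G : Graph) (h : Weight G) → Positive G h → (x : Fin (n G)) →
    PerfectlyDivisible (blowUp G h x) (blowUpWeight G h x) →
    PerfectlyDivisible G h
lemma2 G h positive x divisible S nonempty =
  division-unlift (positive x) divisible (divisible (lift S) (lift-nonempty nonempty))
  where open BlowUp G h x
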